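{- Let $\phi:o_k\to O_B$ be an optimal embedding and let $\phi'$ be the conjugate embedding, $\phi'(a)=\phi(a')$. Then $\phi$ and $\phi'$ are not $O_B^\times$-equivalent, i.e. there is no $u\in O_B^\times$ with $\phi'(a)=u\phi(a)u^{ -1}$ for all $a\in o_k$.
   Context: $B$ is an indefinite quaternion algebra over $\mathbb Q$ with discriminant $D_B$ (so $D_B>1$ or possibly $D_B=1$ is excluded implicitly only through the standing assumption below) and maximal order $O_B$; $k=\mathbb Q(\sqrt\Delta)$ with $\Delta<0$ squarefree even, every prime dividing $D_B$ inert in $k$; $a\mapsto a'$ is Galois conjugation. An embedding $\phi$ is optimal if $\phi(o_k)=\phi(k)\cap O_B$. -}

module Defs where

open import Data.Nat as N using (ℕ)
open import Data.Nat.Primality using (Prime)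
open import Data.Integer as Z using (ℤ; +_)
open import Data.Integer.Divisibility using (_∣_)
open import Data.Rational as Q using (ℚ)
open import Data.Fin using (Fin; zero; suc)
open import Data.Product using (Σ; _×_; ∃; _,_)
open import Data.Sum using (_⊎_)
open import Relation.Nullary using (¬_)
open import Relation.Binary.PropositionalEquality using (_≡_; _≢_)

-- The quaternion algebra B = (a,b)_ℚ with a b nonzero integers:
-- ℚ-basis 1, i, j, k = ij with i² = a, j² = b, ji = -ij.

record Quat : Set where
  constructor ⟨_,_,_,_⟩
  field
    q0 q1 q2 q3 : ℚ
open Quat public

ι : ℤ → ℚ
ι z = z Q./ 1

module QuatAlg (a b : ℤ) where
  private
    A B' : ℚ
    A = ι a
    B' = ι b
  open Q using (_+_; _*_; _-_)

  infixl 7 _·_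
  _·_ : Quat → Quat → Quat
  ⟨ x0 , x1 , x2 , x3 ⟩ · ⟨ y0 , y1 , y2 , y3 ⟩ =
    ⟨ x0 * y0 + A * (x1 * y1) + B' * (x2 * y2) - A * B' * (x3 * y3)
    , x0 * y1 + x1 * y0 - B' * (x2 * y3) + B' * (x3 * y2)
    , x0 * y2 + x2 * y0 + A * (x1 * y3) - A * (x3 * y1)
    , x0 * y3 + x3 * y0 + x1 * y2 - x2 * y1 ⟩

  infixl 6 _⊕_
  _⊕_ : Quat → Quat → Quat
  ⟨ x0 , x1 , x2 , x3 ⟩ ⊕ ⟨ y0 , y1 , y2 , y3 ⟩ =
    ⟨ x0 + y0 , x1 + y1 , x2 + y2 , x3 + y3 ⟩

  _⋆_ : ℚ → Quat → Quat
  c ⋆ ⟨ x0 , x1 , x2 , x3 ⟩ = ⟨ c * x0 , c * x1 , c * x2 , c * x3 ⟩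

  𝟙 : Quat
  𝟙 = ⟨ Q.1ℚ , Q.0ℚ , Q.0ℚ , Q.0ℚ ⟩

  normℤ : ℤ → ℤ → ℤ → ℤ → ℤ
  normℤ x0 x1 x2 x3 =
    x0 Z.* x0 Z.- a Z.* (x1 Z.* x1) Z.- b Z.* (x2 Z.* x2)
      Z.+ a Z.* b Z.* (x3 Z.* x3)

  -- B is indefinite: B ⊗ ℝ ≅ M₂(ℝ), i.e. the (positive somewhere)
  -- reduced norm form is an indefinite quadratic form: it takes a
  -- negative value (rational points are dense, so integer points suffice).
  Indefinite : Set
  Indefinite = Σ ℤ λ x0 → Σ ℤ λ x1 → Σ ℤ λ x2 → Σ ℤ λ x3 →
    normℤ x0 x1 x2 x3 Z.< Z.0ℤ

  -- B is ramified at the prime p: B ⊗ ℚ_p is a division algebra, i.e. the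
  -- norm form has no nontrivial zero over ℚ_p, i.e. (by compactness of ℤ_p)
  -- NOT for every n a primitive integer vector with norm ≡ 0 mod p^n.
  Ramified : ℕ → Set
  Ramified p = ¬ ((n : ℕ) → Σ ℤ λ x0 → Σ ℤ λ x1 → Σ ℤ λ x2 → Σ ℤ λ x3 →
      ¬ ((+ p ∣ x0) × (+ p ∣ x1) × (+ p ∣ x2) × (+ p ∣ x3))
    × (+ (p N.^ n) ∣ normℤ x0 x1 x2 x3))

  DividesDisc : ℕ → Set
  DividesDisc p = Prime p × Ramified p

  Basis : Set
  Basis = Fin 4 → Quat

  lin : (Fin 4 → ℤ) → Basis → Quat
  lin c e = (ι (c zero) ⋆ e zero) ⊕ (ι (c (suc zero)) ⋆ e (suc zero))
          ⊕ (ι (c (suc (suc zero))) ⋆ e (suc (suc zero)))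
          ⊕ (ι (c (suc (suc (suc zero)))) ⋆ e (suc (suc (suc zero))))

  _∈L_ : Quat → Basis → Set
  x ∈L e = Σ (Fin 4 → ℤ) λ c → x ≡ lin c e

  IsOrder : Basis → Set
  IsOrder e = (𝟙 ∈L e)
    × ((x y : Quat) → x ∈L e → y ∈L e → (x · y) ∈L e)
    × ((x : Quat) → Σ ℕ λ n → (n ≢ 0) × ((ι (+ n) ⋆ x) ∈L e))

  IsMaximalOrder : Basis → Set
  IsMaximalOrder e = IsOrder e ×
    ((e' : Basis) → IsOrder e' → ((x : Quat) → x ∈L e → x ∈L e')
       → (x : Quat) → x ∈L e' → x ∈L e)

  IsUnit : Basis → Quat → Set
  IsUnit e u = (u ∈L e) × Σ Quat λ v → (v ∈L e) × (u · v ≡ 𝟙) × (v · u ≡ 𝟙)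

-- k = ℚ(√Δ), Δ squarefree with Δ ≡ 2 mod 4, so o_k = ℤ[√Δ];
-- an element x + y√Δ is represented by the pair (x , y).

Ok : Set
Ok = ℤ × ℤ

module RingOfIntegers (Δ : ℤ) where
  _+ₖ_ : Ok → Ok → Ok
  (x1 , y1) +ₖ (x2 , y2) = (x1 Z.+ x2 , y1 Z.+ y2)

  _*ₖ_ : Ok → Ok → Ok
  (x1 , y1) *ₖ (x2 , y2) = (x1 Z.* x2 Z.+ Δ Z.* (y1 Z.* y2) , x1 Z.* y2 Z.+ x2 Z.* y1)

  1ₖ : Ok
  1ₖ = (+ 1 , + 0)

  conj : Ok → Ok
  conj (x , y) = (x , Z.- y)

  Inert : ℕ → Set
  Inert p = (α β : Ok) →
    let (x1 , y1) = α ; (x2 , y2) = β ; (z , w) = α *ₖ β in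
    (+ p ∣ z) → (+ p ∣ w) → ((+ p ∣ x1) × (+ p ∣ y1)) ⊎ ((+ p ∣ x2) × (+ p ∣ y2))

SquareFree : ℤ → Set
SquareFree Δ = (n : ℤ) → (n Z.* n) ∣ Δ → n ∣ + 1

module Embeddings (a b Δ : ℤ) where
  open QuatAlg a b
  open RingOfIntegers Δ

  IsEmbedding : (Ok → Quat) → Set
  IsEmbedding φ = (φ 1ₖ ≡ 𝟙)
    × ((α β : Ok) → φ (α +ₖ β) ≡ φ α ⊕ φ β)
    × ((α β : Ok) → φ (α *ₖ β) ≡ φ α · φ β)
    × ((α β : Ok) → φ α ≡ φ β → α ≡ β)

  IntoOrder : Basis → (Ok → Quat) → Set
  IntoOrder e φ = (α : Ok) → φ α ∈L e

  -- optimal: φ(k) ∩ O_B = φ(o_k); φ(k) = { q·φ(α) : q ∈ ℚ } = elements x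
  -- with n·x ∈ φ(o_k) for some nonzero n ∈ ℕ.
  Optimal : Basis → (Ok → Quat) → Set
  Optimal e φ = (x : Quat) → x ∈L e →
    (Σ ℕ λ n → (n ≢ 0) × Σ Ok λ α → ι (+ n) ⋆ x ≡ φ α) →
    Σ Ok λ β → x ≡ φ β

  conjEmb : (Ok → Quat) → Ok → Quat
  conjEmb φ α = φ (conj α)

  UnitEquivalent : Basis → (Ok → Quat) → (Ok → Quat) → Set
  UnitEquivalent e φ ψ = Σ Quat λ u → Σ Quat λ v →
    (u ∈L e) × (v ∈L e) × (u · v ≡ 𝟙) × (v · u ≡ 𝟙)
    × ((α : Ok) → ψ α ≡ u · φ α · v)

{-# OPTIONS --safe #-}
-- Let j = φ(√Δ). Since j² = Δ < 0, j is a pure quaternion with nrd j = −Δ > 0. A unit u with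
-- u φ(α) u⁻¹ = φ(α′) anticommutes with j; comparing coordinates, u is pure and orthogonal to j,
-- so u² = c := −nrd u and (u⁻¹)² = c⁻¹ are rational scalars. If c < 0, then j, u, ju give an
-- orthogonal basis on which the norm form is positive (a Gram determinant identity), whereas B is
-- indefinite. If c > 0, both c and c⁻¹ lie in the order, whose scalars have bounded denominators,
-- which forces c = 1; then 1 + u is a nonzero rational zero of the norm form, impossible at a
-- prime where B ramifies.
module Submission where

open import Algebra.Bundles using (CommutativeMonoid)
open import Data.Empty using (⊥; ⊥-elim)
open import Data.Fin using (Fin)
open import Data.Fin.Patterns using (0F; 1F; 2F; 3F)
open import Data.Integer as ℤ using (ℤ; +_; 0ℤ; -[1+_])
import Data.Integer.Properties as ℤP
open import Data.Integer.Divisibility using (_∣_)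
open import Data.Integer.Divisibility.Signed as Signed using (divides; ∣ᵤ⇒∣)
import Data.Integer.Tactic.RingSolver as ℤSolver
open import Data.List using (List; []; _∷_)
open import Data.List.Relation.Unary.All as All using (All)
open import Data.Nat as ℕ using (ℕ; NonZero)
import Data.Nat.Coprimality as Coprimality
import Data.Nat.Divisibility as ℕ∣
open import Data.Nat.Induction using (<-wellFounded)
open import Data.Nat.Primality using (Prime; prime)
import Data.Nat.Properties as ℕP
open import Data.Product using (Σ; ∃; _×_; _,_; proj₁; proj₂)
open import Data.Rational as ℚ using (ℚ; mkℚ; ↥_; ↧ₙ_; _+_; _*_; _-_; -_; 0ℚ; 1ℚ; _<_; _≤_)
import Data.Rational.Properties as ℚP
import Data.Rational.Unnormalised as ℚᵘ
import Data.Rational.Unnormalised.Properties as ℚᵘP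
open import Data.Sum using (inj₁; inj₂)
open import Function using (_∘_)
open import Induction.InfiniteDescent using (Descent; descent∧wf⇒empty)
open import Level using (0ℓ)
open import Relation.Binary.Definitions using (Tri; tri<; tri≈; tri>)
open import Relation.Binary.PropositionalEquality
open import Relation.Nullary using (¬_; Dec; yes; no)
open import Relation.Nullary.Decidable using (dec⇒maybe; _×-dec_)
open import Tactic.RingSolver using (solve-∀)
open import Tactic.RingSolver.Core.AlmostCommutativeRing using (AlmostCommutativeRing; fromCommutativeRing)
open import Algebra.Properties.CommutativeSemigroup
  (CommutativeMonoid.commutativeSemigroup ℚP.*-1-commutativeMonoid) using (x∙yz≈y∙xz; xy∙z≈y∙xz)
open import Algebra.Properties.Group ℚP.+-0-group using (inverseʳ-unique; ⁻¹-involutive)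

open import Defs

open ≡-Reasoning

ℚ-ring : AlmostCommutativeRing 0ℓ 0ℓ
ℚ-ring = fromCommutativeRing ℚP.+-*-commutativeRing (λ x → dec⇒maybe (0ℚ ℚP.≟ x))

x*y≡0⇒y≡0 : ∀ {x y} → x ≢ 0ℚ → x * y ≡ 0ℚ → y ≡ 0ℚ
x*y≡0⇒y≡0 {x} {y} x≢0 xy≡0 = begin
  y                ≡⟨ ℚP.*-identityˡ y ⟨
  1ℚ * y           ≡⟨ cong (_* y) (ℚP.*-inverseˡ x) ⟨
  ℚ.1/ x * x * y   ≡⟨ ℚP.*-assoc (ℚ.1/ x) x y ⟩
  ℚ.1/ x * (x * y) ≡⟨ cong (ℚ.1/ x *_) xy≡0 ⟩
  ℚ.1/ x * 0ℚ      ≡⟨ ℚP.*-zeroʳ (ℚ.1/ x) ⟩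
  0ℚ               ∎
  where instance _ = ℚ.≢-nonZero x≢0

x+x≡0⇒x≡0 : ∀ {x} → x + x ≡ 0ℚ → x ≡ 0ℚ
x+x≡0⇒x≡0 {x} x+x≡0 = x*y≡0⇒y≡0 {1ℚ + 1ℚ} (λ ()) (trans (double x) x+x≡0)
  where
  double : ∀ x → (1ℚ + 1ℚ) * x ≡ x + x
  double = solve-∀ ℚ-ring

x≡x+x⇒x≡0 : ∀ {x} → x ≡ x + x → x ≡ 0ℚ
x≡x+x⇒x≡0 {x} x≡2x = begin
  x         ≡⟨ cancel x x ⟩
  x + x - x ≡⟨ cong (_- x) x≡2x ⟨
  x - x     ≡⟨ ℚP.+-inverseʳ x ⟩
  0ℚ        ∎
  where
  cancel : ∀ x y → x ≡ x + y - y
  cancel = solve-∀ ℚ-ring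

+-nonNeg : ∀ {x y} → 0ℚ ≤ x → 0ℚ ≤ y → 0ℚ ≤ x + y
+-nonNeg {x} {y} 0≤x 0≤y = subst (_≤ x + y) (ℚP.+-identityˡ 0ℚ) (ℚP.+-mono-≤ 0≤x 0≤y)

*-nonNeg : ∀ {x y} → 0ℚ ≤ x → 0ℚ ≤ y → 0ℚ ≤ x * y
*-nonNeg {x} {y} 0≤x 0≤y = ℚP.nonNegative⁻¹ (x * y)
  {{ℚP.nonNeg*nonNeg⇒nonNeg x {{ℚ.nonNegative 0≤x}} y {{ℚ.nonNegative 0≤y}}}}

*-pos : ∀ {x y} → 0ℚ < x → 0ℚ < y → 0ℚ < x * y
*-pos {x} {y} 0<x 0<y = ℚP.positive⁻¹ (x * y)
  {{ℚP.pos*pos⇒pos x {{ℚ.positive 0<x}} y {{ℚ.positive 0<y}}}}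

square-nonNeg : ∀ x → 0ℚ ≤ x * x
square-nonNeg x with ℚP.≤-total 0ℚ x
... | inj₁ 0≤x = *-nonNeg 0≤x 0≤x
... | inj₂ x≤0 = ℚP.nonNegative⁻¹ (x * x)
  {{ℚP.nonPos*nonPos⇒nonPos x {{ℚ.nonPositive x≤0}} x {{ℚ.nonPositive x≤0}}}}

-- ι z = z / 1 is normalised only propositionally; as mkℚ z 0 _ it computes.
ι-as-mkℚ : ∀ z → ι z ≡ mkℚ z 0 (Coprimality.sym (Coprimality.1-coprimeTo ℤ.∣ z ∣))
ι-as-mkℚ z = ℚP.fromℚᵘ-toℚᵘ (mkℚ z 0 _)

ι-+ : ∀ x y → ι (x ℤ.+ y) ≡ ι x + ι y
ι-+ x y = begin
  ι (x ℤ.+ y)                           ≡⟨ cong ι (cong₂ ℤ._+_ (ℤP.*-identityʳ x) (ℤP.*-identityʳ y)) ⟨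
  ι (x ℤ.* + 1 ℤ.+ y ℤ.* + 1)           ≡⟨ cong₂ _+_ (ι-as-mkℚ x) (ι-as-mkℚ y) ⟨
  ι x + ι y                             ∎

ι-* : ∀ x y → ι (x ℤ.* y) ≡ ι x * ι y
ι-* x y = sym (cong₂ _*_ (ι-as-mkℚ x) (ι-as-mkℚ y))

ι-neg : ∀ x → ι (ℤ.- x) ≡ - ι x
ι-neg x = inverseʳ-unique (ι x) (ι (ℤ.- x))
  (trans (sym (ι-+ x (ℤ.- x))) (cong ι (ℤP.+-inverseʳ x)))

ι-injective : ∀ {x y} → ι x ≡ ι y → x ≡ y
ι-injective {x} {y} ιx≡ιy = cong ↥_ (trans (sym (ι-as-mkℚ x)) (trans ιx≡ιy (ι-as-mkℚ y)))

ι-mono-< : ∀ {x y} → x ℤ.< y → ι x < ι y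
ι-mono-< {x} {y} x<y = subst₂ _<_ (sym (ι-as-mkℚ x)) (sym (ι-as-mkℚ y))
  (ℚ.*<* (subst₂ ℤ._<_ (sym (ℤP.*-identityʳ x)) (sym (ℤP.*-identityʳ y)) x<y))

ι-cancel-< : ∀ {x y} → ι x < ι y → x ℤ.< y
ι-cancel-< {x} {y} ιx<ιy = subst₂ ℤ._<_ (ℤP.*-identityʳ x) (ℤP.*-identityʳ y)
  (ℚP.drop-*<* (subst₂ _<_ (ι-as-mkℚ x) (ι-as-mkℚ y) ιx<ιy))

ι-- : ∀ x y → ι (x ℤ.- y) ≡ ι x - ι y
ι-- x y = trans (ι-+ x (ℤ.- y)) (cong (λ s → ι x + s) (ι-neg y))

IsInteger : ℚ → Set
IsInteger r = ∃ λ z → r ≡ ι z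

isInteger-+ : ∀ {x y} → IsInteger x → IsInteger y → IsInteger (x + y)
isInteger-+ (m , refl) (n , refl) = m ℤ.+ n , sym (ι-+ m n)

isInteger-* : ∀ {x y} → IsInteger x → IsInteger y → IsInteger (x * y)
isInteger-* (m , refl) (n , refl) = m ℤ.* n , sym (ι-* m n)

ι-pos-* : ∀ m n → ι (+ (m ℕ.* n)) ≡ ι (+ m) * ι (+ n)
ι-pos-* m n = trans (cong ι (ℤP.pos-* m n)) (ι-* (+ m) (+ n))

denominator-clears : ∀ t → IsInteger (ι (+ ↧ₙ t) * t)
denominator-clears t@(mkℚ n d-1 _) = n , ℚP.toℚᵘ-injective
  (ℚᵘP.≃-trans (ℚP.toℚᵘ-homo-* (ι (+ ℕ.suc d-1)) t)
  (ℚᵘP.≃-trans (ℚᵘP.≃-reflexive (cong (λ s → ℚ.toℚᵘ s ℚᵘ.* ℚ.toℚᵘ t) (ι-as-mkℚ (+ ℕ.suc d-1))))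
  (ℚᵘP.≃-trans (ℚᵘ.*≡* cross-multiplied) (ℚᵘP.≃-reflexive (cong ℚ.toℚᵘ (sym (ι-as-mkℚ n)))))))
  where
  cross-multiplied : (+ ℕ.suc d-1 ℤ.* n) ℤ.* + 1 ≡ n ℤ.* + ℕ.suc (d-1 ℕ.+ 0)
  cross-multiplied rewrite ℕP.+-identityʳ d-1 = trans (ℤP.*-identityʳ _) (ℤP.*-comm (+ ℕ.suc d-1) n)

Clears : ℕ → ℚ → Set
Clears K t = IsInteger (ι (+ K) * t)

common-denominator : (ts : List ℚ) → Σ ℕ λ K → NonZero K × All (Clears K) ts
common-denominator [] = 1 , _ , All.[]
common-denominator (t ∷ ts) with common-denominator ts
... | K , K≢0 , K-clears = ↧ₙ t ℕ.* K , ℕP.m*n≢0 (↧ₙ t) K {{_}} {{K≢0}} ,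
      clears-t All.∷ All.map clears-rest K-clears
  where
  clears-t : Clears (↧ₙ t ℕ.* K) t
  clears-t = subst IsInteger
    (trans (sym (xy∙z≈y∙xz (ι (+ ↧ₙ t)) (ι (+ K)) t)) (cong (_* t) (sym (ι-pos-* (↧ₙ t) K))))
    (isInteger-* (+ K , refl) (denominator-clears t))
  clears-rest : ∀ {s} → Clears K s → Clears (↧ₙ t ℕ.* K) s
  clears-rest {s} K-clears-s = subst IsInteger
    (trans (sym (ℚP.*-assoc (ι (+ ↧ₙ t)) (ι (+ K)) s)) (cong (_* s) (sym (ι-pos-* (↧ₙ t) K))))
    (isInteger-* (+ ↧ₙ t , refl) K-clears-s)

positive-integer : ∀ z → 0ℚ < ι z → ∃ λ m → z ≡ + ℕ.suc m
positive-integer z 0<ιz with ι-cancel-< {0ℤ} {z} 0<ιz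
... | ℤ.+<+ {n = ℕ.suc m} _ = m , refl

-- Quaternion arithmetic

quat-≡ : ∀ {x0 x1 x2 x3 y0 y1 y2 y3} → x0 ≡ y0 → x1 ≡ y1 → x2 ≡ y2 → x3 ≡ y3 →
  ⟨ x0 , x1 , x2 , x3 ⟩ ≡ ⟨ y0 , y1 , y2 , y3 ⟩
quat-≡ refl refl refl refl = refl

scalar : ℚ → Quat
scalar t = ⟨ t , 0ℚ , 0ℚ , 0ℚ ⟩

⊖_ : Quat → Quat
⊖ ⟨ x0 , x1 , x2 , x3 ⟩ = ⟨ - x0 , - x1 , - x2 , - x3 ⟩

im : Quat → Quat
im ⟨ _ , x1 , x2 , x3 ⟩ = ⟨ 0ℚ , x1 , x2 , x3 ⟩

Pure : Quat → Set
Pure x = q0 x ≡ 0ℚ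

Coordinate : Set
Coordinate = ℚ → ℚ → ℚ → ℚ → ℚ

-- The product is repeated here as a let-bound λ-term, and c picks a coordinate: each
-- instance then unfolds to a plain polynomial identity, the form the ring solver reads.
AssociativeAt : Coordinate → Set
AssociativeAt c = ∀ A B x0 x1 x2 x3 y0 y1 y2 y3 z0 z1 z2 z3 →
  let m : Coordinate → ℚ → ℚ → ℚ → ℚ → ℚ → ℚ → ℚ → ℚ → ℚ
      m d a0 a1 a2 a3 b0 b1 b2 b3 =
        d (a0 * b0 + A * (a1 * b1) + B * (a2 * b2) - A * B * (a3 * b3))
          (a0 * b1 + a1 * b0 - B * (a2 * b3) + B * (a3 * b2))
          (a0 * b2 + a2 * b0 + A * (a1 * b3) - A * (a3 * b1))
          (a0 * b3 + a3 * b0 + a1 * b2 - a2 * b1)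
      π0 : Coordinate
      π0 = λ w0 w1 w2 w3 → w0
      π1 : Coordinate
      π1 = λ w0 w1 w2 w3 → w1
      π2 : Coordinate
      π2 = λ w0 w1 w2 w3 → w2
      π3 : Coordinate
      π3 = λ w0 w1 w2 w3 → w3
      xy : Coordinate → ℚ
      xy d = m d x0 x1 x2 x3 y0 y1 y2 y3
      yz : Coordinate → ℚ
      yz d = m d y0 y1 y2 y3 z0 z1 z2 z3
  in m c (xy π0) (xy π1) (xy π2) (xy π3) z0 z1 z2 z3 ≡ m c x0 x1 x2 x3 (yz π0) (yz π1) (yz π2) (yz π3)

associative₀ : AssociativeAt (λ w0 w1 w2 w3 → w0)
associative₀ = solve-∀ ℚ-ring

associative₁ : AssociativeAt (λ w0 w1 w2 w3 → w1)
associative₁ = solve-∀ ℚ-ring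

associative₂ : AssociativeAt (λ w0 w1 w2 w3 → w2)
associative₂ = solve-∀ ℚ-ring

associative₃ : AssociativeAt (λ w0 w1 w2 w3 → w3)
associative₃ = solve-∀ ℚ-ring

module Quaternion (a b : ℤ) where
  open QuatAlg a b using (_·_; 𝟙)

  private
    A B : ℚ
    A = ι a
    B = ι b

  ⟪_,_⟫ : Quat → Quat → ℚ
  ⟪ ⟨ x0 , x1 , x2 , x3 ⟩ , ⟨ y0 , y1 , y2 , y3 ⟩ ⟫ =
    x0 * y0 - A * (x1 * y1) - B * (x2 * y2) + A * B * (x3 * y3)

  nrd : Quat → ℚ
  nrd x = ⟪ x , x ⟫

  ·-assoc : ∀ x y z → (x · y) · z ≡ x · (y · z)
  ·-assoc ⟨ x0 , x1 , x2 , x3 ⟩ ⟨ y0 , y1 , y2 , y3 ⟩ ⟨ z0 , z1 , z2 , z3 ⟩ = quat-≡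
    (associative₀ A B x0 x1 x2 x3 y0 y1 y2 y3 z0 z1 z2 z3) (associative₁ A B x0 x1 x2 x3 y0 y1 y2 y3 z0 z1 z2 z3)
    (associative₂ A B x0 x1 x2 x3 y0 y1 y2 y3 z0 z1 z2 z3) (associative₃ A B x0 x1 x2 x3 y0 y1 y2 y3 z0 z1 z2 z3)

  ·-scalarʳ : ∀ x t → x · scalar t ≡ ⟨ q0 x * t , q1 x * t , q2 x * t , q3 x * t ⟩
  ·-scalarʳ ⟨ x0 , x1 , x2 , x3 ⟩ t = quat-≡
    (coordinate₀ A B x0 x1 x2 x3 t) (coordinate₁ B x0 x1 x2 x3 t)
    (coordinate₂ A x0 x1 x2 x3 t) (coordinate₃ x0 x1 x2 x3 t)
    where
    coordinate₀ : ∀ A B x0 x1 x2 x3 t →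
      x0 * t + A * (x1 * 0ℚ) + B * (x2 * 0ℚ) - A * B * (x3 * 0ℚ) ≡ x0 * t
    coordinate₀ = solve-∀ ℚ-ring
    coordinate₁ : ∀ B x0 x1 x2 x3 t → x0 * 0ℚ + x1 * t - B * (x2 * 0ℚ) + B * (x3 * 0ℚ) ≡ x1 * t
    coordinate₁ = solve-∀ ℚ-ring
    coordinate₂ : ∀ A x0 x1 x2 x3 t → x0 * 0ℚ + x2 * t + A * (x1 * 0ℚ) - A * (x3 * 0ℚ) ≡ x2 * t
    coordinate₂ = solve-∀ ℚ-ring
    coordinate₃ : ∀ x0 x1 x2 x3 t → x0 * 0ℚ + x3 * t + x1 * 0ℚ - x2 * 0ℚ ≡ x3 * t
    coordinate₃ = solve-∀ ℚ-ring

  ·-identityʳ : ∀ x → x · 𝟙 ≡ x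
  ·-identityʳ x@(⟨ x0 , x1 , x2 , x3 ⟩) = trans (·-scalarʳ x 1ℚ)
    (quat-≡ (ℚP.*-identityʳ x0) (ℚP.*-identityʳ x1) (ℚP.*-identityʳ x2) (ℚP.*-identityʳ x3))

  scalar-·-scalar : ∀ s t → scalar s · scalar t ≡ scalar (s * t)
  scalar-·-scalar s t = trans (·-scalarʳ (scalar s) t)
    (quat-≡ refl (ℚP.*-zeroˡ t) (ℚP.*-zeroˡ t) (ℚP.*-zeroˡ t))

  ·-square : ∀ x → x · x ≡
    ⟨ (q0 x + q0 x) * q0 x - nrd x , (q0 x + q0 x) * q1 x , (q0 x + q0 x) * q2 x , (q0 x + q0 x) * q3 x ⟩
  ·-square ⟨ x0 , x1 , x2 , x3 ⟩ = quat-≡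
    (coordinate₀ A B x0 x1 x2 x3) (coordinate₁ B x0 x1 x2 x3)
    (coordinate₂ A x0 x1 x2 x3) (coordinate₃ x0 x1 x2 x3)
    where
    coordinate₀ : ∀ A B x0 x1 x2 x3 →
      x0 * x0 + A * (x1 * x1) + B * (x2 * x2) - A * B * (x3 * x3)
        ≡ (x0 + x0) * x0 - (x0 * x0 - A * (x1 * x1) - B * (x2 * x2) + A * B * (x3 * x3))
    coordinate₀ = solve-∀ ℚ-ring
    coordinate₁ : ∀ B x0 x1 x2 x3 → x0 * x1 + x1 * x0 - B * (x2 * x3) + B * (x3 * x2) ≡ (x0 + x0) * x1
    coordinate₁ = solve-∀ ℚ-ring
    coordinate₂ : ∀ A x0 x1 x2 x3 → x0 * x2 + x2 * x0 + A * (x1 * x3) - A * (x3 * x1) ≡ (x0 + x0) * x2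
    coordinate₂ = solve-∀ ℚ-ring
    coordinate₃ : ∀ x0 x1 x2 x3 → x0 * x3 + x3 * x0 + x1 * x2 - x2 * x1 ≡ (x0 + x0) * x3
    coordinate₃ = solve-∀ ℚ-ring

  pure-square : ∀ x → Pure x → x · x ≡ scalar (- nrd x)
  pure-square x@(⟨ _ , x1 , x2 , x3 ⟩) refl = trans (·-square x)
    (quat-≡ (ℚP.+-identityˡ (- nrd x)) (ℚP.*-zeroˡ x1) (ℚP.*-zeroˡ x2) (ℚP.*-zeroˡ x3))

  negative-square⇒pure : ∀ x {δ} → x · x ≡ scalar δ → δ < 0ℚ → Pure x
  negative-square⇒pure x@(⟨ x0 , x1 , x2 , x3 ⟩) {δ} x²≡δ δ<0 with x0 ℚP.≟ 0ℚ
  ... | yes x0≡0 = x0≡0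
  ... | no x0≢0 =
    ⊥-elim (ℚP.<-irrefl refl (ℚP.≤-<-trans (subst (0ℚ ≤_) x0²≡δ (square-nonNeg x0)) δ<0))
    where
    coordinates : ⟨ (x0 + x0) * x0 - nrd x , (x0 + x0) * x1 , (x0 + x0) * x2 , (x0 + x0) * x3 ⟩ ≡ scalar δ
    coordinates = trans (sym (·-square x)) x²≡δ
    vanishes : ∀ {t} → (x0 + x0) * t ≡ 0ℚ → t ≡ 0ℚ
    vanishes = x*y≡0⇒y≡0 (x0≢0 ∘ x+x≡0⇒x≡0)
    x≡x0 : x ≡ scalar x0
    x≡x0 = quat-≡ refl (vanishes (cong q1 coordinates)) (vanishes (cong q2 coordinates))
                       (vanishes (cong q3 coordinates))
    x0²≡δ : x0 * x0 ≡ δ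
    x0²≡δ = cong q0 (begin
      scalar (x0 * x0)      ≡⟨ scalar-·-scalar x0 x0 ⟨
      scalar x0 · scalar x0 ≡⟨ cong (λ y → y · y) x≡x0 ⟨
      x · x                 ≡⟨ x²≡δ ⟩
      scalar δ              ∎)

  anticommuting⇒orthogonal : ∀ u j → Pure j → nrd j ≢ 0ℚ → u · j ≡ (⊖ j) · u →
    Pure u × ⟪ u , j ⟫ ≡ 0ℚ
  anticommuting⇒orthogonal u@(⟨ u0 , u1 , u2 , u3 ⟩) j@(⟨ _ , j1 , j2 , j3 ⟩) refl nrd-j≢0 anti =
    x*y≡0⇒y≡0 nrd-j≢0 (trans (ℚP.*-comm (nrd j) u0) (x+x≡0⇒x≡0 twice-u0-nrd)) ,
    x+x≡0⇒x≡0 twice-⟪u,j⟫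
    where
    d : (Quat → ℚ) → ℚ
    d q = q ((⊖ j) · u) - q (u · j)
    d≡0 : ∀ q → d q ≡ 0ℚ
    d≡0 q = trans (cong (λ w → q w - q (u · j)) (sym anti)) (ℚP.+-inverseʳ (q (u · j)))
    real-part : ∀ A B u0 u1 u2 u3 j1 j2 j3 →
      let ⟪u,j⟫ = u0 * 0ℚ - A * (u1 * j1) - B * (u2 * j2) + A * B * (u3 * j3) in
      ⟪u,j⟫ + ⟪u,j⟫ ≡ (- 0ℚ * u0 + A * (- j1 * u1) + B * (- j2 * u2) - A * B * (- j3 * u3))
                    - (u0 * 0ℚ + A * (u1 * j1) + B * (u2 * j2) - A * B * (u3 * j3))
    real-part = solve-∀ ℚ-ring
    imaginary-parts : ∀ A B u0 u1 u2 u3 j1 j2 j3 →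
      let d1 = (- 0ℚ * u1 + - j1 * u0 - B * (- j2 * u3) + B * (- j3 * u2))
             - (u0 * j1 + u1 * 0ℚ - B * (u2 * j3) + B * (u3 * j2))
          d2 = (- 0ℚ * u2 + - j2 * u0 + A * (- j1 * u3) - A * (- j3 * u1))
             - (u0 * j2 + u2 * 0ℚ + A * (u1 * j3) - A * (u3 * j1))
          d3 = (- 0ℚ * u3 + - j3 * u0 + - j1 * u2 - - j2 * u1)
             - (u0 * j3 + u3 * 0ℚ + u1 * j2 - u2 * j1)
          nrd-j = 0ℚ * 0ℚ - A * (j1 * j1) - B * (j2 * j2) + A * B * (j3 * j3)
      in u0 * nrd-j + u0 * nrd-j ≡ A * j1 * d1 + B * j2 * d2 - A * B * j3 * d3
    imaginary-parts = solve-∀ ℚ-ring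
    twice-⟪u,j⟫ : ⟪ u , j ⟫ + ⟪ u , j ⟫ ≡ 0ℚ
    twice-⟪u,j⟫ = trans (real-part A B u0 u1 u2 u3 j1 j2 j3) (d≡0 q0)
    twice-u0-nrd : u0 * nrd j + u0 * nrd j ≡ 0ℚ
    twice-u0-nrd = begin
      u0 * nrd j + u0 * nrd j                            ≡⟨ imaginary-parts A B u0 u1 u2 u3 j1 j2 j3 ⟩
      A * j1 * d q1 + B * j2 * d q2 - A * B * j3 * d q3  ≡⟨ cong₂ _-_
        (cong₂ _+_ (cong (A * j1 *_) (d≡0 q1)) (cong (B * j2 *_) (d≡0 q2))) (cong (A * B * j3 *_) (d≡0 q3)) ⟩
      A * j1 * 0ℚ + B * j2 * 0ℚ - A * B * j3 * 0ℚ        ≡⟨ vanishing A B j1 j2 j3 ⟩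
      0ℚ                                                 ∎
      where
      vanishing : ∀ A B j1 j2 j3 → A * j1 * 0ℚ + B * j2 * 0ℚ - A * B * j3 * 0ℚ ≡ 0ℚ
      vanishing = solve-∀ ℚ-ring

  -- The Gram determinant of three pure quaternions is (A B)² det², so with ⟪ u , j ⟫ = 0
  -- nrd j * nrd u * nrd y′ is a sum of squares weighted by nrd j, nrd u and (A B)².
  orthogonal-positive⇒nrd-nonNeg : ∀ j u → Pure j → Pure u → ⟪ u , j ⟫ ≡ 0ℚ →
    0ℚ < nrd j → 0ℚ < nrd u → ∀ y → 0ℚ ≤ nrd y
  orthogonal-positive⇒nrd-nonNeg j@(⟨ _ , j1 , j2 , j3 ⟩) u@(⟨ _ , u1 , u2 , u3 ⟩) refl refl
    ⟪u,j⟫≡0 0<nrd-j 0<nrd-u y@(⟨ y0 , y1 , y2 , y3 ⟩) =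
    subst (0ℚ ≤_) (sym (nrd-split A B y0 y1 y2 y3)) (+-nonNeg (square-nonNeg y0) 0≤nrd-y′)
    where
    y′ : Quat
    y′ = im y
    det : ℚ
    det = j1 * (u2 * y3 - u3 * y2) - j2 * (u1 * y3 - u3 * y1) + j3 * (u1 * y2 - u2 * y1)
    cross : ℚ
    cross = nrd y′ * ⟪ u , j ⟫ - (⟪ u , y′ ⟫ * ⟪ j , y′ ⟫ + ⟪ u , y′ ⟫ * ⟪ j , y′ ⟫)
    nrd-split : ∀ A B y0 y1 y2 y3 →
      y0 * y0 - A * (y1 * y1) - B * (y2 * y2) + A * B * (y3 * y3)
        ≡ y0 * y0 + (0ℚ * 0ℚ - A * (y1 * y1) - B * (y2 * y2) + A * B * (y3 * y3))
    nrd-split = solve-∀ ℚ-ring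
    gram : ∀ A B j1 j2 j3 u1 u2 u3 y1 y2 y3 →
      let β : ℚ → ℚ → ℚ → ℚ → ℚ → ℚ → ℚ
          β v1 v2 v3 w1 w2 w3 = 0ℚ * 0ℚ - A * (v1 * w1) - B * (v2 * w2) + A * B * (v3 * w3)
          Nj = β j1 j2 j3 j1 j2 j3
          Nu = β u1 u2 u3 u1 u2 u3
          Ny = β y1 y2 y3 y1 y2 y3
          ⟪u,y⟫ = β u1 u2 u3 y1 y2 y3
          ⟪j,y⟫ = β j1 j2 j3 y1 y2 y3
          ⟪u,j⟫ = β u1 u2 u3 j1 j2 j3
          det = j1 * (u2 * y3 - u3 * y2) - j2 * (u1 * y3 - u3 * y1) + j3 * (u1 * y2 - u2 * y1)
      in Nj * Nu * Ny ≡ Nj * (⟪u,y⟫ * ⟪u,y⟫) + Nu * (⟪j,y⟫ * ⟪j,y⟫) + A * B * (A * B) * (det * det)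
                        + ⟪u,j⟫ * (Ny * ⟪u,j⟫ - (⟪u,y⟫ * ⟪j,y⟫ + ⟪u,y⟫ * ⟪j,y⟫))
    gram = solve-∀ ℚ-ring
    sum-nonNeg : 0ℚ ≤ nrd j * nrd u * nrd y′
    sum-nonNeg = subst (0ℚ ≤_) (sym (gram A B j1 j2 j3 u1 u2 u3 y1 y2 y3))
      (+-nonNeg (+-nonNeg (+-nonNeg (*-nonNeg (ℚP.<⇒≤ 0<nrd-j) (square-nonNeg ⟪ u , y′ ⟫))
                                    (*-nonNeg (ℚP.<⇒≤ 0<nrd-u) (square-nonNeg ⟪ j , y′ ⟫)))
                          (*-nonNeg (square-nonNeg (A * B)) (square-nonNeg det)))
                (ℚP.≤-reflexive (sym (trans (cong (_* cross) ⟪u,j⟫≡0) (ℚP.*-zeroˡ cross)))))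
    0≤nrd-y′ : 0ℚ ≤ nrd y′
    0≤nrd-y′ = ℚP.*-cancelˡ-≤-pos (nrd j * nrd u) {{ℚ.positive (*-pos 0<nrd-j 0<nrd-u)}}
      (subst (_≤ nrd j * nrd u * nrd y′) (sym (ℚP.*-zeroʳ (nrd j * nrd u))) sum-nonNeg)

  ·-scalar≡𝟙 : ∀ w c → w · scalar c ≡ 𝟙 → w ≡ scalar (q0 w) × c * q0 w ≡ 1ℚ
  ·-scalar≡𝟙 w@(⟨ w0 , w1 , w2 , w3 ⟩) c wc≡1 =
    quat-≡ refl (vanishes (cong q1 wc≡1′)) (vanishes (cong q2 wc≡1′)) (vanishes (cong q3 wc≡1′)) ,
    trans (ℚP.*-comm c w0) (cong q0 wc≡1′)
    where
    wc≡1′ : ⟨ w0 * c , w1 * c , w2 * c , w3 * c ⟩ ≡ 𝟙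
    wc≡1′ = trans (sym (·-scalarʳ w c)) wc≡1
    c≢0 : c ≢ 0ℚ
    c≢0 refl = ℚP.1≢0 (trans (sym (cong q0 wc≡1′)) (ℚP.*-zeroʳ w0))
    vanishes : ∀ {t} → t * c ≡ 0ℚ → t ≡ 0ℚ
    vanishes {t} tc≡0 = x*y≡0⇒y≡0 c≢0 (trans (ℚP.*-comm c t) tc≡0)

  square-of-inverse : ∀ u v c → v · u ≡ 𝟙 → u · u ≡ scalar c →
    v · v ≡ scalar (q0 (v · v)) × c * q0 (v · v) ≡ 1ℚ
  square-of-inverse u v c vu≡1 u²≡c = ·-scalar≡𝟙 (v · v) c (begin
    v · v · scalar c      ≡⟨ cong (v · v ·_) u²≡c ⟨
    v · v · (u · u)       ≡⟨ ·-assoc (v · v) u u ⟨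
    v · v · u · u         ≡⟨ cong (_· u) (·-assoc v v u) ⟩
    v · (v · u) · u       ≡⟨ cong (λ w → v · w · u) vu≡1 ⟩
    v · 𝟙 · u             ≡⟨ cong (_· u) (·-identityʳ v) ⟩
    v · u                 ≡⟨ vu≡1 ⟩
    𝟙                     ∎)

  nrd-scaled-1+pure : ∀ D u → Pure u → nrd ⟨ D , D * q1 u , D * q2 u , D * q3 u ⟩ ≡ D * D * (1ℚ + nrd u)
  nrd-scaled-1+pure D ⟨ _ , u1 , u2 , u3 ⟩ refl = identity A B D u1 u2 u3
    where
    identity : ∀ A B D u1 u2 u3 →
      D * D - A * (D * u1 * (D * u1)) - B * (D * u2 * (D * u2)) + A * B * (D * u3 * (D * u3))
        ≡ D * D * (1ℚ + (0ℚ * 0ℚ - A * (u1 * u1) - B * (u2 * u2) + A * B * (u3 * u3)))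
    identity = solve-∀ ℚ-ring

-- The norm form, indefiniteness and ramification

module NormForm (a b : ℤ) where
  open QuatAlg a b using (normℤ; Ramified; DividesDisc)
  open Quaternion a b using (nrd; nrd-scaled-1+pure)

  ι-normℤ : ∀ x0 x1 x2 x3 → ι (normℤ x0 x1 x2 x3) ≡ nrd ⟨ ι x0 , ι x1 , ι x2 , ι x3 ⟩
  ι-normℤ x0 x1 x2 x3 =
    trans (ι-+ (x0 ℤ.* x0 ℤ.- a ℤ.* (x1 ℤ.* x1) ℤ.- b ℤ.* (x2 ℤ.* x2)) (a ℤ.* b ℤ.* (x3 ℤ.* x3))) (cong₂ _+_
      (trans (ι-- (x0 ℤ.* x0 ℤ.- a ℤ.* (x1 ℤ.* x1)) (b ℤ.* (x2 ℤ.* x2))) (cong₂ _-_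
        (trans (ι-- (x0 ℤ.* x0) (a ℤ.* (x1 ℤ.* x1))) (cong₂ _-_ (ι-* x0 x0) (ι-*² a x1 x1)))
        (ι-*² b x2 x2)))
      (trans (ι-* (a ℤ.* b) (x3 ℤ.* x3)) (cong₂ _*_ (ι-* a b) (ι-* x3 x3))))
    where
    ι-*² : ∀ c x y → ι (c ℤ.* (x ℤ.* y)) ≡ ι c * (ι x * ι y)
    ι-*² c x y = trans (ι-* c (x ℤ.* y)) (cong (ι c *_) (ι-* x y))

  normℤ-scale : ∀ x0 x1 x2 x3 p →
    normℤ (x0 ℤ.* p) (x1 ℤ.* p) (x2 ℤ.* p) (x3 ℤ.* p) ≡ normℤ x0 x1 x2 x3 ℤ.* (p ℤ.* p)
  normℤ-scale x0 x1 x2 x3 p = identity a b x0 x1 x2 x3 p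
    where
    identity : ∀ a b x0 x1 x2 x3 p →
      let N : ℤ → ℤ → ℤ → ℤ → ℤ
          N y0 y1 y2 y3 = y0 ℤ.* y0 ℤ.- a ℤ.* (y1 ℤ.* y1) ℤ.- b ℤ.* (y2 ℤ.* y2) ℤ.+ a ℤ.* b ℤ.* (y3 ℤ.* y3)
      in N (x0 ℤ.* p) (x1 ℤ.* p) (x2 ℤ.* p) (x3 ℤ.* p) ≡ N x0 x1 x2 x3 ℤ.* (p ℤ.* p)
    identity = ℤSolver.solve-∀

  IsotropicVector : ℕ → Set
  IsotropicVector n = Σ ℤ λ x0 → Σ ℤ λ x1 → Σ ℤ λ x2 → Σ ℤ λ x3 →
    x0 ≢ 0ℤ × ℤ.∣ x0 ∣ ≡ n × normℤ x0 x1 x2 x3 ≡ 0ℤ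

  -- A zero with all coordinates divisible by p can be divided by p, which lowers ∣ x0 ∣;
  -- any other zero is a zero modulo every power of p, which ramification at p excludes.
  ramified⇒anisotropic : ∀ {p} → Prime p → Ramified p → ∀ n → IsotropicVector n → ⊥
  ramified⇒anisotropic {p} (prime {{nontrivial}} _) ramified = descent∧wf⇒empty descent <-wellFounded
    where
    instance
      p≢0 : NonZero p
      p≢0 = ℕ.nonTrivial⇒nonZero p {{nontrivial}}
    Divisible : ℤ → ℤ → ℤ → ℤ → Set
    Divisible x0 x1 x2 x3 = (+ p Signed.∣ x0) × (+ p Signed.∣ x1) × (+ p Signed.∣ x2) × (+ p Signed.∣ x3)
    divide : ∀ {n} x0 x1 x2 x3 → x0 ≢ 0ℤ → ℤ.∣ x0 ∣ ≡ n → normℤ x0 x1 x2 x3 ≡ 0ℤ →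
      Dec (Divisible x0 x1 x2 x3) → ∃ λ m → m ℕ.< n × IsotropicVector m
    divide x0 x1 x2 x3 _ _ N≡0 (no indivisible) = ⊥-elim (ramified λ n →
      x0 , x1 , x2 , x3 ,
      (λ (d0 , d1 , d2 , d3) → indivisible (∣ᵤ⇒∣ d0 , ∣ᵤ⇒∣ d1 , ∣ᵤ⇒∣ d2 , ∣ᵤ⇒∣ d3)) ,
      subst (λ z → + (p ℕ.^ n) ∣ z) (sym N≡0) ((p ℕ.^ n) ℕ∣.∣0))
    divide ._ ._ ._ ._ x0≢0 refl N≡0 (yes (divides q0 refl , divides q1 refl , divides q2 refl , divides q3 refl)) =
      ℤ.∣ q0 ∣ , smaller , q0 , q1 , q2 , q3 , q0≢0 , refl , Nq≡0
      where
      q0≢0 : q0 ≢ 0ℤ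
      q0≢0 refl = x0≢0 refl
      smaller : ℤ.∣ q0 ∣ ℕ.< ℤ.∣ q0 ℤ.* + p ∣
      smaller = subst (ℤ.∣ q0 ∣ ℕ.<_) (sym (ℤP.abs-* q0 (+ p)))
        (ℕP.m<m*n ℤ.∣ q0 ∣ p {{ℤ.≢-nonZero q0≢0}} (ℕ.nonTrivial⇒n>1 p {{nontrivial}}))
      Nq≡0 : normℤ q0 q1 q2 q3 ≡ 0ℤ
      Nq≡0 = ℤP.*-cancelʳ-≡ _ _ (+ (p ℕ.* p)) {{ℕP.m*n≢0 p p}} (begin
        normℤ q0 q1 q2 q3 ℤ.* + (p ℕ.* p)                              ≡⟨ cong (normℤ q0 q1 q2 q3 ℤ.*_) (ℤP.pos-* p p) ⟩
        normℤ q0 q1 q2 q3 ℤ.* (+ p ℤ.* + p)                            ≡⟨ normℤ-scale q0 q1 q2 q3 (+ p) ⟨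
        normℤ (q0 ℤ.* + p) (q1 ℤ.* + p) (q2 ℤ.* + p) (q3 ℤ.* + p)    ≡⟨ N≡0 ⟩
        0ℤ                                                             ≡⟨ ℤP.*-zeroˡ (+ (p ℕ.* p)) ⟨
        0ℤ ℤ.* + (p ℕ.* p)                                             ∎)
    descent : Descent ℕ._<_ IsotropicVector
    descent (x0 , x1 , x2 , x3 , x0≢0 , ∣x0∣≡n , N≡0) =
      divide x0 x1 x2 x3 x0≢0 ∣x0∣≡n N≡0
        ((+ p Signed.∣? x0) ×-dec (+ p Signed.∣? x1) ×-dec (+ p Signed.∣? x2) ×-dec (+ p Signed.∣? x3))

  ramified⇒nrd-pure≢-1 : ∀ {p} → Prime p → Ramified p → ∀ u → Pure u → nrd u ≢ - 1ℚ
  ramified⇒nrd-pure≢-1 p-prime ramified u pure-u nrd-u≡-1 =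
    isotropic (common-denominator (q1 u ∷ q2 u ∷ q3 u ∷ []))
    where
    isotropic : (Σ ℕ λ D → NonZero D × All (Clears D) (q1 u ∷ q2 u ∷ q3 u ∷ [])) → ⊥
    isotropic (ℕ.suc d , _ , (z1 , e1) All.∷ (z2 , e2) All.∷ (z3 , e3) All.∷ All.[]) =
      ramified⇒anisotropic p-prime ramified _ (+ D , z1 , z2 , z3 , (λ ()) , refl , ι-injective N≡0)
      where
      D : ℕ
      D = ℕ.suc d
      N≡0 : ι (normℤ (+ D) z1 z2 z3) ≡ ι 0ℤ
      N≡0 = begin
        ι (normℤ (+ D) z1 z2 z3)                                      ≡⟨ ι-normℤ (+ D) z1 z2 z3 ⟩
        nrd ⟨ ι (+ D) , ι z1 , ι z2 , ι z3 ⟩                          ≡⟨ cong nrd (quat-≡ (refl {x = ι (+ D)}) e1 e2 e3) ⟨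
        nrd ⟨ ι (+ D) , ι (+ D) * q1 u , ι (+ D) * q2 u , ι (+ D) * q3 u ⟩ ≡⟨ nrd-scaled-1+pure (ι (+ D)) u pure-u ⟩
        ι (+ D) * ι (+ D) * (1ℚ + nrd u)                              ≡⟨ cong (λ t → ι (+ D) * ι (+ D) * (1ℚ + t)) nrd-u≡-1 ⟩
        ι (+ D) * ι (+ D) * (1ℚ - 1ℚ)                                 ≡⟨ cong (ι (+ D) * ι (+ D) *_) (ℚP.+-inverseʳ 1ℚ) ⟩
        ι (+ D) * ι (+ D) * 0ℚ                                        ≡⟨ ℚP.*-zeroʳ (ι (+ D) * ι (+ D)) ⟩
        ι 0ℤ                                                          ∎

  indefinite⇒nrd-negative : QuatAlg.Indefinite a b → ∃ λ y → nrd y < 0ℚ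
  indefinite⇒nrd-negative (x0 , x1 , x2 , x3 , N<0) =
    ⟨ ι x0 , ι x1 , ι x2 , ι x3 ⟩ , subst (_< 0ℚ) (ι-normℤ x0 x1 x2 x3) (ι-mono-< N<0)

-- Scalars in orders

module Orders (a b : ℤ) where
  open QuatAlg a b using (Basis; _∈L_; IsOrder)
  open Quaternion a b using (scalar-·-scalar)

  lattice-scalars-bounded : (e : Basis) → Σ ℕ λ K → NonZero K × (∀ t → scalar t ∈L e → Clears K t)
  lattice-scalars-bounded e = bounded (common-denominator (r 0F ∷ r 1F ∷ r 2F ∷ r 3F ∷ []))
    where
    r : Fin 4 → ℚ
    r i = q0 (e i)
    distribute : ∀ k z0 z1 z2 z3 r0 r1 r2 r3 →
      k * (z0 * r0 + z1 * r1 + z2 * r2 + z3 * r3) ≡ z0 * (k * r0) + z1 * (k * r1) + z2 * (k * r2) + z3 * (k * r3)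
    distribute = solve-∀ ℚ-ring
    bounded : (Σ ℕ λ K → NonZero K × All (Clears K) (r 0F ∷ r 1F ∷ r 2F ∷ r 3F ∷ [])) →
      Σ ℕ λ K → NonZero K × (∀ t → scalar t ∈L e → Clears K t)
    bounded (K , K≢0 , c0 All.∷ c1 All.∷ c2 All.∷ c3 All.∷ All.[]) = K , K≢0 , clears
      where
      clears : ∀ t → scalar t ∈L e → Clears K t
      clears t (z , t≡lin) = subst IsInteger
        (trans (sym (distribute (ι (+ K)) (ι (z 0F)) (ι (z 1F)) (ι (z 2F)) (ι (z 3F)) (r 0F) (r 1F) (r 2F) (r 3F)))
               (cong (ι (+ K) *_) (sym (cong q0 t≡lin))))
        (isInteger-+ (isInteger-+ (isInteger-+ (isInteger-* (z 0F , refl) c0) (isInteger-* (z 1F , refl) c1))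
                                  (isInteger-* (z 2F , refl) c2))
                     (isInteger-* (z 3F , refl) c3))

  -- K * t runs through ℕ for the scalars t of the order, and multiplying by r lowers it.
  no-scalar-between-0-and-1 : ∀ e → IsOrder e → ∀ r → scalar r ∈L e → 0ℚ < r → r < 1ℚ → ⊥
  no-scalar-between-0-and-1 e (1∈e , closed , _) r r∈e 0<r r<1 = impossible (lattice-scalars-bounded e)
    where
    impossible : (Σ ℕ λ K → NonZero K × (∀ t → scalar t ∈L e → Clears K t)) → ⊥
    impossible (ℕ.suc k , _ , clears) = descent∧wf⇒empty descent <-wellFounded k (1ℚ , 1∈e , ℚP.*-identityʳ _)
      where
      K : ℕ
      K = ℕ.suc k
      Scaled : ℕ → Set
      Scaled n = Σ ℚ λ t → scalar t ∈L e × ι (+ K) * t ≡ ι (+ ℕ.suc n)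
      descent : Descent ℕ._<_ Scaled
      descent {n} (t , t∈e , Kt≡n) = lower (clears (r * t) rt∈e)
        where
        rt∈e : scalar (r * t) ∈L e
        rt∈e = subst (_∈L e) (scalar-·-scalar r t) (closed _ _ r∈e t∈e)
        Krt≡rKt : ι (+ K) * (r * t) ≡ r * ι (+ ℕ.suc n)
        Krt≡rKt = trans (x∙yz≈y∙xz (ι (+ K)) r t) (cong (r *_) Kt≡n)
        0<n : 0ℚ < ι (+ ℕ.suc n)
        0<n = ι-mono-< {0ℤ} {+ ℕ.suc n} (ℤ.+<+ (ℕ.s≤s ℕ.z≤n))
        rKt<Kt : r * ι (+ ℕ.suc n) < ι (+ ℕ.suc n)
        rKt<Kt = subst (r * ι (+ ℕ.suc n) <_) (ℚP.*-identityˡ _)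
          (ℚP.*-monoˡ-<-pos (ι (+ ℕ.suc n)) {{ℚ.positive 0<n}} r<1)
        lower : IsInteger (ι (+ K) * (r * t)) → ∃ λ m → m ℕ.< n × Scaled m
        lower (z , Krt≡z) with positive-integer z (subst (0ℚ <_) (trans (sym Krt≡rKt) Krt≡z) (*-pos 0<r 0<n))
        ... | m , refl = m , ℕP.≤-pred (ℤP.drop‿+<+ (ι-cancel-< m<n)) , r * t , rt∈e , Krt≡z
          where
          m<n : ι (+ ℕ.suc m) < ι (+ ℕ.suc n)
          m<n = subst (_< ι (+ ℕ.suc n)) (trans (sym Krt≡rKt) Krt≡z) rKt<Kt

  positive-unit-scalar≡1 : ∀ e → IsOrder e → ∀ c c′ → 0ℚ < c → c * c′ ≡ 1ℚ →
    scalar c ∈L e → scalar c′ ∈L e → c ≡ 1ℚ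
  positive-unit-scalar≡1 e order c c′ 0<c cc′≡1 c∈e c′∈e with ℚP.<-cmp c 1ℚ
  ... | tri< c<1 _ _ = ⊥-elim (no-scalar-between-0-and-1 e order c c∈e 0<c c<1)
  ... | tri≈ _ c≡1 _ = c≡1
  ... | tri> _ _ 1<c = ⊥-elim (no-scalar-between-0-and-1 e order c′ c′∈e 0<c′ c′<1)
    where
    0<c′ : 0ℚ < c′
    0<c′ = ℚP.*-cancelˡ-<-nonNeg c {{ℚ.nonNegative (ℚP.<⇒≤ 0<c)}}
      (subst₂ _<_ (sym (ℚP.*-zeroʳ c)) (sym cc′≡1) (ℚP.positive⁻¹ 1ℚ))
    c′<1 : c′ < 1ℚ
    c′<1 = subst₂ _<_ (ℚP.*-identityʳ c′) (trans (ℚP.*-comm c′ c) cc′≡1)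
      (ℚP.*-monoʳ-<-pos c′ {{ℚ.positive 0<c′}} 1<c)

-- Embeddings of o_k and the conjugating unit

module AdditiveMaps (a b Δ : ℤ) where
  open QuatAlg a b using (_⊕_)
  open RingOfIntegers Δ using (_+ₖ_; 1ₖ)

  module _ (φ : Ok → Quat) (φ-+ : ∀ α β → φ (α +ₖ β) ≡ φ α ⊕ φ β) where

    φ-0 : φ (0ℤ , 0ℤ) ≡ scalar 0ℚ
    φ-0 = quat-≡ (x≡x+x⇒x≡0 (cong q0 φ0≡2φ0)) (x≡x+x⇒x≡0 (cong q1 φ0≡2φ0))
                 (x≡x+x⇒x≡0 (cong q2 φ0≡2φ0)) (x≡x+x⇒x≡0 (cong q3 φ0≡2φ0))
      where
      φ0≡2φ0 : φ (0ℤ , 0ℤ) ≡ φ (0ℤ , 0ℤ) ⊕ φ (0ℤ , 0ℤ)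
      φ0≡2φ0 = φ-+ (0ℤ , 0ℤ) (0ℤ , 0ℤ)

    φ-neg : ∀ x y → φ (ℤ.- x , ℤ.- y) ≡ ⊖ φ (x , y)
    φ-neg x y = quat-≡ (inverse (cong q0 sum≡0)) (inverse (cong q1 sum≡0))
                       (inverse (cong q2 sum≡0)) (inverse (cong q3 sum≡0))
      where
      sum≡0 : φ (x , y) ⊕ φ (ℤ.- x , ℤ.- y) ≡ scalar 0ℚ
      sum≡0 = begin
        φ (x , y) ⊕ φ (ℤ.- x , ℤ.- y) ≡⟨ φ-+ (x , y) (ℤ.- x , ℤ.- y) ⟨
        φ (x ℤ.+ ℤ.- x , y ℤ.+ ℤ.- y) ≡⟨ cong₂ (λ s t → φ (s , t)) (ℤP.+-inverseʳ x) (ℤP.+-inverseʳ y) ⟩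
        φ (0ℤ , 0ℤ)                   ≡⟨ φ-0 ⟩
        scalar 0ℚ                     ∎
      inverse : ∀ {s t} → s + t ≡ 0ℚ → t ≡ - s
      inverse {s} {t} = inverseʳ-unique s t

    module _ (φ-1 : φ 1ₖ ≡ scalar 1ℚ) where

      φ-ℕ : ∀ n → φ (+ n , 0ℤ) ≡ scalar (ι (+ n))
      φ-ℕ ℕ.zero = φ-0
      φ-ℕ (ℕ.suc n) = begin
        φ (+ ℕ.suc n , 0ℤ)             ≡⟨ cong (λ k → φ (+ k , 0ℤ)) (ℕP.+-comm 1 n) ⟩
        φ ((+ n , 0ℤ) +ₖ 1ₖ)           ≡⟨ φ-+ (+ n , 0ℤ) 1ₖ ⟩
        φ (+ n , 0ℤ) ⊕ φ 1ₖ           ≡⟨ cong₂ _⊕_ (φ-ℕ n) φ-1 ⟩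
        scalar (ι (+ n)) ⊕ scalar 1ℚ  ≡⟨ cong scalar (ι-+ (+ n) (+ 1)) ⟨
        scalar (ι (+ (n ℕ.+ 1)))       ≡⟨ cong (λ k → scalar (ι (+ k))) (ℕP.+-comm n 1) ⟩
        scalar (ι (+ ℕ.suc n))         ∎

      φ-ℤ : ∀ n → φ (n , 0ℤ) ≡ scalar (ι n)
      φ-ℤ (+ n) = φ-ℕ n
      φ-ℤ -[1+ n ] = begin
        φ (-[1+ n ] , 0ℤ)              ≡⟨ φ-neg (+ ℕ.suc n) 0ℤ ⟩
        ⊖ φ (+ ℕ.suc n , 0ℤ)           ≡⟨ cong ⊖_ (φ-ℕ (ℕ.suc n)) ⟩
        scalar (- ι (+ ℕ.suc n))       ≡⟨ cong scalar (ι-neg (+ ℕ.suc n)) ⟨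
        scalar (ι -[1+ n ])            ∎

module ImaginaryUnit (a b Δ : ℤ) where
  open QuatAlg a b using (_·_)
  open Quaternion a b using (·-assoc; ·-identityʳ)
  open RingOfIntegers Δ using (_*ₖ_; conj)
  open Embeddings a b Δ using (IsEmbedding; conjEmb)
  open AdditiveMaps a b Δ using (φ-neg; φ-ℤ)

  √Δ : Ok
  √Δ = 0ℤ , + 1

  embedded-√Δ-square : ∀ φ → IsEmbedding φ → φ √Δ · φ √Δ ≡ scalar (ι Δ)
  embedded-√Δ-square φ (φ-1 , φ-+ , φ-* , _) = begin
    φ √Δ · φ √Δ     ≡⟨ φ-* √Δ √Δ ⟨
    φ (√Δ *ₖ √Δ)    ≡⟨ cong (λ n → φ (n , 0ℤ)) (trans (ℤP.+-identityˡ (Δ ℤ.* + 1)) (ℤP.*-identityʳ Δ)) ⟩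
    φ (Δ , 0ℤ)      ≡⟨ φ-ℤ φ φ-+ φ-1 Δ ⟩
    scalar (ι Δ)    ∎

  conjugating-unit-anticommutes : ∀ φ → IsEmbedding φ → ∀ u v → v · u ≡ scalar 1ℚ →
    (∀ α → conjEmb φ α ≡ u · φ α · v) → u · φ √Δ ≡ (⊖ φ √Δ) · u
  conjugating-unit-anticommutes φ (_ , φ-+ , _) u v vu≡1 conjugates = begin
    u · φ √Δ                  ≡⟨ ·-identityʳ (u · φ √Δ) ⟨
    u · φ √Δ · scalar 1ℚ      ≡⟨ cong (u · φ √Δ ·_) vu≡1 ⟨
    u · φ √Δ · (v · u)        ≡⟨ ·-assoc (u · φ √Δ) v u ⟨
    u · φ √Δ · v · u          ≡⟨ cong (_· u) (conjugates √Δ) ⟨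
    φ (conj √Δ) · u           ≡⟨ cong (_· u) (φ-neg φ φ-+ 0ℤ (+ 1)) ⟩
    (⊖ φ √Δ) · u              ∎

module AnticommutingUnits (a b : ℤ) where
  open QuatAlg a b using (Indefinite; DividesDisc; IsOrder; _∈L_; _·_)
  open Quaternion a b
  open NormForm a b using (ramified⇒nrd-pure≢-1; indefinite⇒nrd-negative)
  open Orders a b using (positive-unit-scalar≡1)

  no-anticommuting-unit : Indefinite → ∀ {p} → DividesDisc p → ∀ e → IsOrder e →
    ∀ {δ} → δ < 0ℚ → ∀ j u v → j · j ≡ scalar δ → u ∈L e → v ∈L e →
    v · u ≡ scalar 1ℚ → u · j ≡ (⊖ j) · u → ⊥
  no-anticommuting-unit indefinite (p-prime , ramified) e order@(_ , closed , _) {δ} δ<0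
    j u v j²≡δ u∈e v∈e vu≡1 anti = by-sign-of-nrd-u (ℚP.<-cmp 0ℚ (nrd u))
    where
    pure-j : Pure j
    pure-j = negative-square⇒pure j j²≡δ δ<0
    -nrd-j≡δ : - nrd j ≡ δ
    -nrd-j≡δ = cong q0 (trans (sym (pure-square j pure-j)) j²≡δ)
    0<nrd-j : 0ℚ < nrd j
    0<nrd-j = subst (0ℚ <_) (trans (cong -_ (sym -nrd-j≡δ)) (⁻¹-involutive (nrd j))) (ℚP.neg-antimono-< δ<0)
    pure-u×u⊥j : Pure u × ⟪ u , j ⟫ ≡ 0ℚ
    pure-u×u⊥j = anticommuting⇒orthogonal u j pure-j (λ nrd-j≡0 → ℚP.<-irrefl (sym nrd-j≡0) 0<nrd-j) anti
    pure-u : Pure u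
    pure-u = proj₁ pure-u×u⊥j
    u² : u · u ≡ scalar (- nrd u)
    u² = pure-square u pure-u
    v²×inverse : v · v ≡ scalar (q0 (v · v)) × - nrd u * q0 (v · v) ≡ 1ℚ
    v²×inverse = square-of-inverse u v (- nrd u) vu≡1 u²
    c′ : ℚ
    c′ = q0 (v · v)
    by-sign-of-nrd-u : Tri (0ℚ < nrd u) (0ℚ ≡ nrd u) (nrd u < 0ℚ) → ⊥
    by-sign-of-nrd-u (tri< 0<nrd-u _ _) with indefinite⇒nrd-negative indefinite
    ... | y , nrd-y<0 = ℚP.<-irrefl refl (ℚP.≤-<-trans
      (orthogonal-positive⇒nrd-nonNeg j u pure-j pure-u (proj₂ pure-u×u⊥j) 0<nrd-j 0<nrd-u y) nrd-y<0)
    by-sign-of-nrd-u (tri≈ _ 0≡nrd-u _) = ℚP.1≢0 (begin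
      1ℚ               ≡⟨ proj₂ v²×inverse ⟨
      - nrd u * c′     ≡⟨ cong (λ t → - t * c′) 0≡nrd-u ⟨
      0ℚ * c′          ≡⟨ ℚP.*-zeroˡ c′ ⟩
      0ℚ               ∎)
    by-sign-of-nrd-u (tri> _ _ nrd-u<0) = ramified⇒nrd-pure≢-1 p-prime ramified u pure-u
      (ℚP.neg-injective {q = - 1ℚ} (positive-unit-scalar≡1 e order (- nrd u) c′ (ℚP.neg-antimono-< nrd-u<0)
        (proj₂ v²×inverse) (subst (_∈L e) u² (closed u u u∈e u∈e))
        (subst (_∈L e) (proj₁ v²×inverse) (closed v v v∈e v∈e))))

lemma4p6 : (a b : ℤ) → a ≢ 0ℤ → b ≢ 0ℤ → QuatAlg.Indefinite a b
    → Σ ℕ (QuatAlg.DividesDisc a b)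
    → (Δ : ℤ) → Δ ℤ.< 0ℤ → SquareFree Δ → (+ 2 ∣ Δ)
    → ((p : ℕ) → QuatAlg.DividesDisc a b p → RingOfIntegers.Inert Δ p)
    → (e : QuatAlg.Basis a b) → QuatAlg.IsMaximalOrder a b e
    → (φ : Ok → Quat) → Embeddings.IsEmbedding a b Δ φ
    → Embeddings.IntoOrder a b Δ e φ → Embeddings.Optimal a b Δ e φ
    → ¬ Embeddings.UnitEquivalent a b Δ e φ (Embeddings.conjEmb a b Δ φ)
lemma4p6 a b _ _ indefinite (_ , p∣D) Δ Δ<0 _ _ _ e (order , _) φ embedding _ _
  (u , v , u∈e , v∈e , _ , vu≡1 , conjugates) =
  AnticommutingUnits.no-anticommuting-unit a b indefinite p∣D e order (ι-mono-< Δ<0) (φ √Δ) u v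
    (embedded-√Δ-square φ embedding) u∈e v∈e vu≡1
    (conjugating-unit-anticommutes φ embedding u v vu≡1 conjugates)
  where open ImaginaryUnit a b Δ
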